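{- Let $G=(V,E)$ be a graph, let $X\subseteq V$ be such that $G-X$ is a 2-plex cluster graph, and let $M\subseteq V$ be any vertex set. Suppose that every connected component of $G-X$ contains a vertex with a neighbor in $X$. Then there are at most $|M|$ vertex sets $H$ of connected components of $G-X$ such that no vertex of $H\setminus M$ has a neighbor in $X$.
   Context: All graphs are finite, simple and undirected. A 2-plex is a graph in which every vertex is nonadjacent to at most one other vertex; a 2-plex cluster graph is a graph each of whose connected components is a 2-plex. -}

module Defs where

open import Data.Nat using (ℕ)
open import Data.Fin using (Fin)
open import Data.Fin.Subset using (Subset; _∈_; _∉_)
open import Data.Product using (Σ; _×_; ∃)
open import Relation.Nullary using (¬_)
open import Relation.Binary.PropositionalEquality using (_≡_; _≢_)

record Graph (n : ℕ) : Set₁ where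
  field
    Adj     : Fin n → Fin n → Set
    sym     : ∀ {u v} → Adj u v → Adj v u
    irrefl  : ∀ {v} → ¬ Adj v v
open Graph public

data Reach {n : ℕ} (G : Graph n) (X : Subset n) : Fin n → Fin n → Set where
  here : ∀ {u} → u ∉ X → Reach G X u u
  step : ∀ {u v w} → Reach G X u v → Adj G v w → w ∉ X → Reach G X u w

IsComponent : {n : ℕ} → Graph n → Subset n → Subset n → Set
IsComponent G X H =
  Σ _ λ v → v ∉ X × (∀ w → (w ∈ H → Reach G X v w) × (Reach G X v w → w ∈ H))

Is2Plex : {n : ℕ} → Graph n → Subset n → Set
Is2Plex G H = ∀ v u w → v ∈ H → u ∈ H → w ∈ H → u ≢ v → w ≢ v →
  ¬ Adj G v u → ¬ Adj G v w → u ≡ w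

Is2PlexCluster : {n : ℕ} → Graph n → Subset n → Set
Is2PlexCluster G X = ∀ H → IsComponent G X H → Is2Plex G H

HasNbrIn : {n : ℕ} → Graph n → Subset n → Fin n → Set
HasNbrIn G X v = ∃ λ x → x ∈ X × Adj G v x

module Submission where

-- Every component H of G - X contains a vertex with a
-- neighbour in X; if no vertex of H \ M has such a neighbour, this vertex
-- must lie in M.  Distinct components of G - X are disjoint, so choosing one
-- such vertex of M for each listed component is injective, and the number of
-- components is at most |M|.

open import Defs
open import Data.Nat using (ℕ; _≤_; z≤n; s≤s)
open import Data.Nat.Properties using (≤-trans)
open import Data.Fin using (Fin)
open import Data.Fin.Subset using (Subset; _∈_; _∉_; ∣_∣; _-_)
open import Data.Fin.Subset.Properties
  using (_∈?_; ⊆-antisym; x∈p⇒∣p-x∣<∣p∣; x∈p∧x≢y⇒x∈p-y)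
open import Data.Product using (_×_; ∃; _,_; proj₁; proj₂)
open import Data.List using (List; length; []; _∷_)
open import Data.List.Relation.Unary.All as All using (All; []; _∷_)
open import Data.List.Relation.Unary.Unique.Propositional using (Unique)
open import Data.List.Relation.Unary.AllPairs using ([]; _∷_)
open import Relation.Nullary using (¬_)
open import Relation.Nullary.Decidable using (decidable-stable)
open import Relation.Binary.PropositionalEquality using (_≡_; _≢_; refl)

-- Induction on the list: the representative v of the head is removed from M,
-- and the tail is still represented inside M - v.
representatives-bound :
  ∀ {a ℓ} {A : Set a} {n : ℕ} (R : A → Fin n → Set ℓ) →
  (∀ {x y v} → R x v → R y v → x ≡ y) →
  ∀ {M : Subset n} (xs : List A) → Unique xs →
  All (λ x → ∃ λ v → v ∈ M × R x v) xs →
  length xs ≤ ∣ M ∣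
representatives-bound R shared⇒equal [] _ _ = z≤n
representatives-bound R shared⇒equal {M} (x ∷ xs) (x≢xs ∷ unique-xs)
  ((v , v∈M , Rxv) ∷ represented-xs) =
  ≤-trans (s≤s (representatives-bound R shared⇒equal xs unique-xs
                  (All.zipWith avoid-v (x≢xs , represented-xs))))
          (x∈p⇒∣p-x∣<∣p∣ v∈M)
  where
  -- The representative of any y ≢ x differs from v, hence survives in M - v.
  avoid-v : ∀ {y} → x ≢ y × (∃ λ w → w ∈ M × R y w) →
            ∃ λ w → w ∈ M - v × R y w
  avoid-v (x≢y , w , w∈M , Ryw) =
    w , x∈p∧x≢y⇒x∈p-y w∈M (λ { refl → x≢y (shared⇒equal Rxv Ryw) }) , Ryw

module _ {n : ℕ} (G : Graph n) (X : Subset n) where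

  reach-source∉ : ∀ {u v} → Reach G X u v → u ∉ X
  reach-source∉ (here u∉X)   = u∉X
  reach-source∉ (step r _ _) = reach-source∉ r

  reach-trans : ∀ {u v w} → Reach G X u v → Reach G X v w → Reach G X u w
  reach-trans r (here _)         = r
  reach-trans r (step s v~w w∉X) = step (reach-trans r s) v~w w∉X

  reach-sym : ∀ {u v} → Reach G X u v → Reach G X v u
  reach-sym (here u∉X)       = here u∉X
  reach-sym (step r v~w w∉X) =
    reach-trans (step (here w∉X) (Graph.sym G v~w) (reach-source∉ (reach-sym r)))
                (reach-sym r)

  component-connected : ∀ {H u w} → IsComponent G X H →
                        u ∈ H → w ∈ H → Reach G X u w
  component-connected (_ , _ , spans) u∈H w∈H =
    reach-trans (reach-sym (proj₁ (spans _) u∈H)) (proj₁ (spans _) w∈H)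

  component-closed : ∀ {H u w} → IsComponent G X H →
                     u ∈ H → Reach G X u w → w ∈ H
  component-closed (_ , _ , spans) u∈H u⇝w =
    proj₂ (spans _) (reach-trans (proj₁ (spans _) u∈H) u⇝w)

  -- Components sharing a vertex u coincide: each is the set of vertices
  -- reachable from u.
  components-overlap⇒equal : ∀ {H K u} → IsComponent G X H → IsComponent G X K →
                             u ∈ H → u ∈ K → H ≡ K
  components-overlap⇒equal cH cK u∈H u∈K =
    ⊆-antisym (λ w∈H → component-closed cK u∈K (component-connected cH u∈H w∈H))
              (λ w∈K → component-closed cH u∈H (component-connected cK u∈K w∈K))

  Represents : Subset n → Fin n → Set
  Represents H v = IsComponent G X H × v ∈ H

  represented-component-unique : ∀ {H K v} → Represents H v → Represents K v → H ≡ K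
  represented-component-unique (cH , v∈H) (cK , v∈K) =
    components-overlap⇒equal cH cK v∈H v∈K

mainTheorem7 : {n : ℕ} (G : Graph n) (X M : Subset n) →
    Is2PlexCluster G X →
    (∀ H → IsComponent G X H → ∃ λ v → v ∈ H × HasNbrIn G X v) →
    (Hs : List (Subset n)) → Unique Hs →
    All (λ H → IsComponent G X H × (∀ v → v ∈ H → v ∉ M → ¬ HasNbrIn G X v)) Hs →
    length Hs ≤ ∣ M ∣
mainTheorem7 G X M _ touches-X Hs unique-Hs listed =
  representatives-bound (Represents G X) (represented-component-unique G X)
                        Hs unique-Hs (All.map representative listed)
  where
  representative : ∀ {H} →
    IsComponent G X H × (∀ v → v ∈ H → v ∉ M → ¬ HasNbrIn G X v) →
    ∃ λ v → v ∈ M × Represents G X H v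
  representative {H} (cH , untouched-off-M) with touches-X H cH
  ... | v , v∈H , v-touches =
    v , decidable-stable (v ∈? M) (λ v∉M → untouched-off-M v v∈H v∉M v-touches)
      , cH , v∈H
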